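{- Let $A,B>0$, $q$ a natural number, and $f:\mathbb{Z}\to\mathbb{C}$ a function with $|f(m)|\le A$ and $f(m+q)=f(m)$ for all $m\in\mathbb{Z}$, and $\sum_{m=1}^{q}\left|\sum_{k=1}^{K}f(m+k)\right|^2\le BqK$ for all natural $K$. Fix an integer $n\ge0$, an integer $a$, and a positive integer $N$; let $\tau$ be the integer with $\frac{q_n^{\tau}-1}{2}\le N<\frac{q_n^{\tau+1}-1}{2}$, and for $0\le i\le\tau$ put $K_i=\frac{q_n^{\tau-i}-1}{2}$. Then there are integers $a_{j,n}$ ($0\le j\le n$) and $b_{j,n}$ ($0\le j\le n-2$), depending only on $n$, such that for every $1\le i\le\tau-1$, \[ T_{ - }^{(n)}(a,K_{i})=\alpha_nT_{ - }(a,K_{i})-\beta_nT_{+}(a-K_i,K_{i})+\sum_{j=0}^na_{j,n}S_{ - }^{(j)}(a,K_{i})-\sum_{j=0}^{n-2}b_{j,n}S_{+}^{(j)}(a,K_{i}), \] \[ T_{+}^{(n)}(a,K_{i})=\alpha_nT_{+}(a-K_i,K_{i})-\beta_nT_{ - }(a,K_{i})+\sum_{j=0}^na_{j,n}S_{+}^{(j)}(a,K_{i})-\sum_{j=0}^{n-2}b_{j,n}S_{ - }^{(j)}(a,K_{i}), \] where $\alpha_n=\frac{q_n+1}{2}$ and $\beta_n=\frac{q_n-1}{2}$.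
   Context: The sequence $(q_n)_{n\ge -2}$ is defined by $q_{ -2}=q_{ -1}=1$, $q_n=2q_{n-1}+q_{n-2}$ for $n\ge0$; and $c_n=\frac{q_n-1}{2}$ for $n\ge-2$. For integers $x$ and $y\ge0$: $T_{ - }(x,y)=\sum_{k=1}^{y}(y+1-k)f(x+k)$, $T_{+}(x,y)=\sum_{k=1}^{y}k f(x+k)$, $S(x,y)=\sum_{i=x+1}^{x+y}\sum_{j=0}^{y-1}f(i+j)$. For integers $j\ge 0$ and $K\ge0$: $T_{+}^{(j)}(a,K)=T_{+}(a-q_jK-c_j,\,q_jK+c_j)$, $T_{ - }^{(j)}(a,K)=T_{ - }(a,\,q_jK+c_j)$, $S_{+}^{(j)}(a,K)=S(a-q_jK-c_j,\,(q_{j-2}+q_{j-1})K+c_j-c_{j-1})$, $S_{ - }^{(j)}(a,K)=S(a-q_{j-2}K-c_{j-2},\,(q_{j-2}+q_{j-1})K+c_j-c_{j-1})$. -}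

module Defs where

open import Level using (Level)
open import Data.Nat using (ℕ; zero; suc; _∸_; ⌊_/2⌋) renaming (_+_ to _+ℕ_; _*_ to _*ℕ_)
open import Data.Integer using (ℤ; +_; -[1+_]) renaming (_+_ to _+ℤ_; _-_ to _-ℤ_)
open import Algebra.Bundles using (AbelianGroup)

-- The sequence q_m for m ≥ -2, shifted by two:  qs k = q_{k-2}.
-- q_{-2} = q_{-1} = 1,  q_n = 2 q_{n-1} + q_{n-2}.
qs : ℕ → ℕ
qs zero = 1
qs (suc zero) = 1
qs (suc (suc k)) = 2 *ℕ qs (suc k) +ℕ qs k

-- cs k = c_{k-2} = (q_{k-2} - 1)/2  (exact: every q_m is odd)
cs : ℕ → ℕ
cs k = ⌊ qs k ∸ 1 /2⌋

q : ℕ → ℕ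
q j = qs (2 +ℕ j)

c : ℕ → ℕ
c j = cs (2 +ℕ j)

α : ℕ → ℕ
α n = ⌊ q n +ℕ 1 /2⌋

β : ℕ → ℕ
β n = ⌊ q n ∸ 1 /2⌋

module Sums {a ℓ : Level} (G : AbelianGroup a ℓ) (f : ℤ → AbelianGroup.Carrier G) where
  open AbelianGroup G

  _·_ : ℕ → Carrier → Carrier
  zero · x = ε
  suc n · x = (n · x) ∙ x

  _·ℤ_ : ℤ → Carrier → Carrier
  (+ n) ·ℤ x = n · x
  -[1+ n ] ·ℤ x = (suc n · x) ⁻¹

  Σ1 : ℕ → (ℕ → Carrier) → Carrier
  Σ1 zero g = ε
  Σ1 (suc y) g = Σ1 y g ∙ g (suc y)

  T₋ : ℤ → ℕ → Carrier
  T₋ x y = Σ1 y (λ k → (suc y ∸ k) · f (x +ℤ + k))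

  T₊ : ℤ → ℕ → Carrier
  T₊ x y = Σ1 y (λ k → k · f (x +ℤ + k))

  -- S(x,y) = Σ_{i=x+1}^{x+y} Σ_{j=0}^{y-1} f(i+j)
  --        = Σ_{i'=1}^{y} Σ_{j'=1}^{y} f(x + i' + (j' - 1))
  S : ℤ → ℕ → Carrier
  S x y = Σ1 y (λ i → Σ1 y (λ j → f (x +ℤ + i +ℤ + (j ∸ 1))))

  -- length (q_{j-2} + q_{j-1}) K + c_j - c_{j-1}   (nonnegative, as c is nondecreasing)
  lenS : ℕ → ℕ → ℕ
  lenS j K = (qs j +ℕ qs (suc j)) *ℕ K +ℕ c j ∸ cs (suc j)

  T₊⁽_⁾ : ℕ → ℤ → ℕ → Carrier
  T₊⁽ j ⁾ a K = T₊ (a -ℤ + (q j *ℕ K +ℕ c j)) (q j *ℕ K +ℕ c j)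

  T₋⁽_⁾ : ℕ → ℤ → ℕ → Carrier
  T₋⁽ j ⁾ a K = T₋ a (q j *ℕ K +ℕ c j)

  S₊⁽_⁾ : ℕ → ℤ → ℕ → Carrier
  S₊⁽ j ⁾ a K = S (a -ℤ + (q j *ℕ K +ℕ c j)) (lenS j K)

  -- q_{j-2} = qs j,  c_{j-2} = cs j
  S₋⁽_⁾ : ℕ → ℤ → ℕ → Carrier
  S₋⁽ j ⁾ a K = S (a -ℤ + (qs j *ℕ K +ℕ cs j)) (lenS j K)

  Σ0 : ℕ → (ℕ → Carrier) → Carrier
  Σ0 m g = Σ1 (suc m) (λ j → g (j ∸ 1))

  -- Σ_{j=0}^{n-2} g j  (empty when n < 2)
  Σ0to-2 : ℕ → (ℕ → Carrier) → Carrier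
  Σ0to-2 n g = Σ1 (n ∸ 1) (λ j → g (j ∸ 1))

module Submission where

-- Put ℓ_s = q_{s-2} K + c_{s-2}, so that ℓ_0 = ℓ_1 = K and ℓ_{s+2} = 2ℓ_{s+1} + ℓ_s + 1,
-- and X_s = T₋(a, ℓ_s), Y_s = T₊(a − ℓ_s, ℓ_s); then T₋⁽ⁿ⁾ = X_{n+2}, T₊⁽ⁿ⁾ = Y_{n+2}.
--  1. With the second-order prefix sums Φ of f, each of T₋, T₊ and S is a second
--     difference of Φ.  Comparing multiplicities gives the recurrences
--       X_{s+2} + Y_s = 2X_{s+1} + S₋⁽ˢ⁾,   Y_{s+2} + X_s = 2Y_{s+1} + S₊⁽ˢ⁾.
--  2. This paired linear recurrence is solved by induction on s:
--       X_s = (c_{s-2} + 1) X_1 − c_{s-2} Y_1 + Σ_j A_s(j) S₋⁽ʲ⁾ − Σ_j B_s(j) S₊⁽ʲ⁾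
--     with recursively defined coefficients A_s, B_s, and symmetrically for Y_s.
--  3. At s = n + 2 one has c_n + 1 = α_n, c_n = β_n, and B_{n+2}(j) = 0 for j > n − 2.
-- The identity is purely algebraic: it holds in every abelian group, for all f and K.
-- Identities are stated without differences (as t ∙ p ≈ r) so that the commutative
-- monoid solver applies; the lemmas `transfer` and `eliminate` combine them.

open import Defs
open import Level using (Level)
open import Data.Nat using (ℕ; zero; suc; _∸_; _^_; _≤_; _<_; z≤n; s≤s; ⌊_/2⌋) renaming (_+_ to _+ℕ_; _*_ to _*ℕ_)
open import Data.Integer using (ℤ; +_; _+_) renaming (_-_ to _-ℤ_)
open import Data.Product using (Σ-syntax; _×_; _,_; proj₁; proj₂)
open import Data.Sum using (inj₁; inj₂)
open import Algebra.Bundles using (AbelianGroup)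
import Data.Nat.Properties as ℕ
import Data.Integer.Properties as ℤ
import Data.Nat.Tactic.RingSolver as ℕ-Solver
import Data.Integer.Tactic.RingSolver as ℤ-Solver
open import Relation.Binary.PropositionalEquality as ≡ using (_≡_)

-- Arithmetic of the sequences q, c and of the lengths q_{s-2} K + c_{s-2}.
module Arithmetic where

  -- ĉ s = c_{s-2}, computed by the recurrence c_m = 2 c_{m-1} + c_{m-2} + 1
  -- that follows from q_m = 2 c_m + 1.
  ĉ : ℕ → ℕ
  ĉ zero = 0
  ĉ (suc zero) = 0
  ĉ (suc (suc s)) = suc (ĉ (suc s) +ℕ ĉ (suc s) +ℕ ĉ s)

  qs-odd : ∀ s → qs s ≡ suc (ĉ s +ℕ ĉ s)
  qs-odd zero = ≡.refl
  qs-odd (suc zero) = ≡.refl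
  qs-odd (suc (suc s)) rewrite qs-odd (suc s) | qs-odd s = expand (ĉ (suc s)) (ĉ s)
    where
    expand : ∀ x y → 2 *ℕ suc (x +ℕ x) +ℕ suc (y +ℕ y) ≡ suc (suc (x +ℕ x +ℕ y) +ℕ suc (x +ℕ x +ℕ y))
    expand = ℕ-Solver.solve-∀

  cs≡ĉ : ∀ s → cs s ≡ ĉ s
  cs≡ĉ s rewrite qs-odd s = ≡.sym (ℕ.n≡⌊n+n/2⌋ (ĉ s))

  α≡ : ∀ n → α n ≡ suc (ĉ (2 +ℕ n))
  α≡ n rewrite qs-odd (2 +ℕ n) = half-succ (ĉ (2 +ℕ n))
    where
    half-succ : ∀ x → ⌊ suc (x +ℕ x) +ℕ 1 /2⌋ ≡ suc x
    half-succ x rewrite ℕ.+-comm (suc (x +ℕ x)) 1 = ≡.cong suc (≡.sym (ℕ.n≡⌊n+n/2⌋ x))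

  β≡ : ∀ n → β n ≡ ĉ (2 +ℕ n)
  β≡ n rewrite qs-odd (2 +ℕ n) = ≡.sym (ℕ.n≡⌊n+n/2⌋ (ĉ (2 +ℕ n)))

  len : ℕ → ℕ → ℕ
  len K s = qs s *ℕ K +ℕ cs s

  len-1 : ∀ K → len K 1 ≡ K
  len-1 K = ≡.trans (ℕ.+-identityʳ _) (ℕ.+-identityʳ K)

  len-step : ∀ K s → len K (2 +ℕ s) ≡ suc (len K (1 +ℕ s) +ℕ len K (1 +ℕ s) +ℕ len K s)
  len-step K s rewrite cs≡ĉ (2 +ℕ s) | cs≡ĉ (1 +ℕ s) | cs≡ĉ s =
    expand (qs (1 +ℕ s)) (qs s) K (ĉ (1 +ℕ s)) (ĉ s)
    where
    expand : ∀ a b k x y → (2 *ℕ a +ℕ b) *ℕ k +ℕ suc (x +ℕ x +ℕ y) ≡ suc (a *ℕ k +ℕ x +ℕ (a *ℕ k +ℕ x) +ℕ (b *ℕ k +ℕ y))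
    expand = ℕ-Solver.solve-∀

  lenS≡ : ∀ K s → (qs s +ℕ qs (1 +ℕ s)) *ℕ K +ℕ cs (2 +ℕ s) ∸ cs (1 +ℕ s) ≡ suc (len K (1 +ℕ s) +ℕ len K s)
  lenS≡ K s rewrite cs≡ĉ (2 +ℕ s) | cs≡ĉ (1 +ℕ s) | cs≡ĉ s =
    ≡.trans (≡.cong (_∸ ĉ (1 +ℕ s)) (expand (qs s) (qs (1 +ℕ s)) K (ĉ (1 +ℕ s)) (ĉ s)))
            (ℕ.m+n∸n≡m _ (ĉ (1 +ℕ s)))
    where
    expand : ∀ a b k x y → (a +ℕ b) *ℕ k +ℕ suc (x +ℕ x +ℕ y) ≡ suc (b *ℕ k +ℕ x +ℕ (a *ℕ k +ℕ y)) +ℕ x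
    expand = ℕ-Solver.solve-∀

  -- Kronecker delta; it inserts the inhomogeneous term of index s at step s + 2.
  δ : ℕ → ℕ → ℕ
  δ zero zero = 1
  δ zero (suc _) = 0
  δ (suc _) zero = 0
  δ (suc s) (suc j) = δ s j

  δ-diag : ∀ s → δ s s ≡ 1
  δ-diag zero = ≡.refl
  δ-diag (suc s) = δ-diag s

  δ-below : ∀ {s j} → j < s → δ s j ≡ 0
  δ-below {suc s} {zero} _ = ≡.refl
  δ-below {suc s} {suc j} (s≤s j<s) = δ-below j<s

  δ-above : ∀ {s j} → s < j → δ s j ≡ 0
  δ-above {zero} {suc j} _ = ≡.refl
  δ-above {suc s} {suc j} (s≤s s<j) = δ-above s<j

  -- The coefficients of the unrolled recurrence (see PairedRecurrence below):
  -- coefA s j and coefB s j are the multiplicities with which the inhomogeneous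
  -- terms of index j enter the s-th member of the solution.
  mutual
    coefA : ℕ → ℕ → ℕ
    coefA zero j = 0
    coefA (suc zero) j = 0
    coefA (suc (suc s)) j = coefA (suc s) j +ℕ coefA (suc s) j +ℕ coefB s j +ℕ δ s j

    coefB : ℕ → ℕ → ℕ
    coefB zero j = 0
    coefB (suc zero) j = 0
    coefB (suc (suc s)) j = coefA s j +ℕ (coefB (suc s) j +ℕ coefB (suc s) j)

  mutual
    coefA-vanishes : ∀ {s j} → s ≤ suc j → coefA s j ≡ 0
    coefA-vanishes {zero} _ = ≡.refl
    coefA-vanishes {suc zero} _ = ≡.refl
    coefA-vanishes {suc (suc s)} {j} (s≤s s≤j) =
      ≡.cong₂ _+ℕ_
        (≡.cong₂ _+ℕ_
          (≡.cong₂ _+ℕ_ (coefA-vanishes (ℕ.m≤n⇒m≤1+n s≤j)) (coefA-vanishes (ℕ.m≤n⇒m≤1+n s≤j)))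
          (coefB-vanishes (ℕ.≤-trans (ℕ.n≤1+n s) (ℕ.≤-trans s≤j (ℕ.m≤n+m j 3)))))
        (δ-above s≤j)

    coefB-vanishes : ∀ {s j} → s ≤ 3 +ℕ j → coefB s j ≡ 0
    coefB-vanishes {zero} _ = ≡.refl
    coefB-vanishes {suc zero} _ = ≡.refl
    coefB-vanishes {suc (suc s)} (s≤s (s≤s s≤1+j)) =
      ≡.cong₂ _+ℕ_ (coefA-vanishes s≤1+j)
        (≡.cong₂ _+ℕ_ (coefB-vanishes (s≤s (ℕ.m≤n⇒m≤1+n s≤1+j))) (coefB-vanishes (s≤s (ℕ.m≤n⇒m≤1+n s≤1+j))))

module Development {g ℓ : Level} (G : AbelianGroup g ℓ) (f : ℤ → AbelianGroup.Carrier G) where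
  open AbelianGroup G
  open Sums G f
  open Arithmetic
  open import Algebra.Properties.AbelianGroup G using (∙-cancelʳ)
  open import Relation.Binary.Reasoning.Setoid setoid
  open import Algebra.Solver.CommutativeMonoid commutativeMonoid using (solve; _⊕_; _⊜_; id)

  ·-+ : ∀ m n x → (m +ℕ n) · x ≈ m · x ∙ n · x
  ·-+ zero n x = sym (identityˡ _)
  ·-+ (suc m) n x = begin
    (m +ℕ n) · x ∙ x      ≈⟨ ∙-congʳ (·-+ m n x) ⟩
    (m · x ∙ n · x) ∙ x   ≈⟨ solve 3 (λ a b c → (a ⊕ b) ⊕ c ⊜ (a ⊕ c) ⊕ b) refl (m · x) (n · x) x ⟩
    (m · x ∙ x) ∙ n · x   ∎

  ·-∙ : ∀ n x y → n · (x ∙ y) ≈ n · x ∙ n · y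
  ·-∙ zero x y = sym (identityˡ ε)
  ·-∙ (suc n) x y = begin
    n · (x ∙ y) ∙ (x ∙ y)       ≈⟨ ∙-congʳ (·-∙ n x y) ⟩
    (n · x ∙ n · y) ∙ (x ∙ y)   ≈⟨ solve 4 (λ a b c d → (a ⊕ b) ⊕ (c ⊕ d) ⊜ (a ⊕ c) ⊕ (b ⊕ d)) refl (n · x) (n · y) x y ⟩
    (n · x ∙ x) ∙ (n · y ∙ y)   ∎

  ·-cong : ∀ n {x y} → x ≈ y → n · x ≈ n · y
  ·-cong zero eq = refl
  ·-cong (suc n) eq = ∙-cong (·-cong n eq) eq

  ·-ε : ∀ n → n · ε ≈ ε
  ·-ε zero = refl
  ·-ε (suc n) = trans (identityʳ _) (·-ε n)

  ·-2u+v+1 : ∀ u v x → suc (u +ℕ u +ℕ v) · x ≈ ((u · x ∙ u · x) ∙ v · x) ∙ x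
  ·-2u+v+1 u v x = ∙-congʳ (trans (·-+ (u +ℕ u) v x) (∙-congʳ (·-+ u u x)))

  Σ1-cong : ∀ y {g h : ℕ → Carrier} → (∀ k → k < y → g (suc k) ≈ h (suc k)) → Σ1 y g ≈ Σ1 y h
  Σ1-cong zero eq = refl
  Σ1-cong (suc y) eq = ∙-cong (Σ1-cong y (λ k k<y → eq k (ℕ.m<n⇒m<1+n k<y))) (eq y ℕ.≤-refl)

  Σ1-∙ : ∀ y (g h : ℕ → Carrier) → Σ1 y (λ k → g k ∙ h k) ≈ Σ1 y g ∙ Σ1 y h
  Σ1-∙ zero g h = sym (identityˡ ε)
  Σ1-∙ (suc y) g h = begin
    Σ1 y (λ k → g k ∙ h k) ∙ (g (suc y) ∙ h (suc y))  ≈⟨ ∙-congʳ (Σ1-∙ y g h) ⟩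
    (Σ1 y g ∙ Σ1 y h) ∙ (g (suc y) ∙ h (suc y))       ≈⟨ solve 4 (λ a b c d → (a ⊕ b) ⊕ (c ⊕ d) ⊜ (a ⊕ c) ⊕ (b ⊕ d)) refl _ _ _ _ ⟩
    (Σ1 y g ∙ g (suc y)) ∙ (Σ1 y h ∙ h (suc y))       ∎

  Σ1-· : ∀ y n (g : ℕ → Carrier) → Σ1 y (λ k → n · g k) ≈ n · Σ1 y g
  Σ1-· zero n g = sym (·-ε n)
  Σ1-· (suc y) n g = trans (∙-congʳ (Σ1-· y n g)) (sym (·-∙ n _ _))

  Σ1-const : ∀ y x → Σ1 y (λ _ → x) ≈ y · x
  Σ1-const zero x = refl
  Σ1-const (suc y) x = ∙-congʳ (Σ1-const y x)

  Σ1-ε : ∀ y (g : ℕ → Carrier) → (∀ k → k < y → g (suc k) ≈ ε) → Σ1 y g ≈ ε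
  Σ1-ε y g eq = trans (Σ1-cong y eq) (trans (Σ1-const y ε) (·-ε y))

  Σ1-truncate : ∀ {y z} (g : ℕ → Carrier) → y ≤ z → (∀ k → y ≤ k → k < z → g (suc k) ≈ ε) → Σ1 z g ≈ Σ1 y g
  Σ1-truncate {y} {zero} g z≤n _ = refl
  Σ1-truncate {y} {suc z} g y≤1+z vanish with ℕ.m≤n⇒m<n∨m≡n y≤1+z
  ... | inj₁ (s≤s y≤z) = begin
    Σ1 z g ∙ g (suc z)  ≈⟨ ∙-cong (Σ1-truncate g y≤z (λ k y≤k k<z → vanish k y≤k (ℕ.m<n⇒m<1+n k<z))) (vanish z y≤z ℕ.≤-refl) ⟩
    Σ1 y g ∙ ε          ≈⟨ identityʳ _ ⟩
    Σ1 y g              ∎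
  ... | inj₂ ≡.refl = refl

  Σ1-descending-weights : ∀ y (g : ℕ → Carrier) → Σ1 y (λ k → (suc y ∸ k) · g k) ≈ Σ1 y (λ k → Σ1 k g)
  Σ1-descending-weights zero g = refl
  Σ1-descending-weights (suc y) g = begin
    Σ1 (suc y) (λ k → (suc (suc y) ∸ k) · g k)
      ≈⟨ Σ1-cong (suc y) (λ k k<1+y → reflexive (≡.cong (_· g (suc k)) (ℕ.+-∸-assoc 1 (ℕ.≤-pred k<1+y)))) ⟩
    Σ1 (suc y) (λ k → (suc y ∸ k) · g k ∙ g k)
      ≈⟨ Σ1-∙ (suc y) (λ k → (suc y ∸ k) · g k) g ⟩
    (Σ1 y (λ k → (suc y ∸ k) · g k) ∙ (y ∸ y) · g (suc y)) ∙ Σ1 (suc y) g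
      ≈⟨ ∙-congʳ (∙-cong (Σ1-descending-weights y g) (reflexive (≡.cong (_· g (suc y)) (ℕ.n∸n≡0 y)))) ⟩
    (Σ1 y (λ k → Σ1 k g) ∙ ε) ∙ Σ1 (suc y) g
      ≈⟨ ∙-congʳ (identityʳ _) ⟩
    Σ1 y (λ k → Σ1 k g) ∙ Σ1 (suc y) g ∎

  Σ1-complementary-weights : ∀ y (g : ℕ → Carrier) →
    Σ1 y (λ k → k · g k) ∙ Σ1 y (λ k → (suc y ∸ k) · g k) ≈ suc y · Σ1 y g
  Σ1-complementary-weights y g = begin
    Σ1 y (λ k → k · g k) ∙ Σ1 y (λ k → (suc y ∸ k) · g k)  ≈⟨ Σ1-∙ y _ _ ⟨
    Σ1 y (λ k → k · g k ∙ (suc y ∸ k) · g k)               ≈⟨ Σ1-cong y weights ⟩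
    Σ1 y (λ k → suc y · g k)                                ≈⟨ Σ1-· y (suc y) g ⟩
    suc y · Σ1 y g                                          ∎
    where
    weights : ∀ k → k < y → suc k · g (suc k) ∙ (suc y ∸ suc k) · g (suc k) ≈ suc y · g (suc k)
    weights k k<y = trans (sym (·-+ (suc k) (suc y ∸ suc k) _))
                          (reflexive (≡.cong (_· g (suc k)) (ℕ.m+[n∸m]≡n (ℕ.m≤n⇒m≤1+n k<y))))

  transfer : ∀ {t₁ t₂ t₃ t₄ p₁ p₂ p₃ p₄ r₁ r₂ r₃ r₄} →
    t₁ ∙ p₁ ≈ r₁ → t₂ ∙ p₂ ≈ r₂ → t₃ ∙ p₃ ≈ r₃ → t₄ ∙ p₄ ≈ r₄ →
    (r₁ ∙ r₂) ∙ (2 · p₃ ∙ p₄) ≈ (2 · r₃ ∙ r₄) ∙ (p₁ ∙ p₂) →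
    t₁ ∙ t₂ ≈ 2 · t₃ ∙ t₄
  transfer {t₁} {t₂} {t₃} {t₄} {p₁} {p₂} {p₃} {p₄} {r₁} {r₂} {r₃} {r₄} e₁ e₂ e₃ e₄ balanced =
    ∙-cancelʳ ((p₁ ∙ p₂) ∙ (2 · p₃ ∙ p₄)) _ _ (begin
      (t₁ ∙ t₂) ∙ ((p₁ ∙ p₂) ∙ (2 · p₃ ∙ p₄))
        ≈⟨ solve 5 (λ a b c d e → (a ⊕ b) ⊕ ((c ⊕ d) ⊕ e) ⊜ ((a ⊕ c) ⊕ (b ⊕ d)) ⊕ e) refl t₁ t₂ p₁ p₂ (2 · p₃ ∙ p₄) ⟩
      ((t₁ ∙ p₁) ∙ (t₂ ∙ p₂)) ∙ (2 · p₃ ∙ p₄)   ≈⟨ ∙-congʳ (∙-cong e₁ e₂) ⟩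
      (r₁ ∙ r₂) ∙ (2 · p₃ ∙ p₄)                ≈⟨ balanced ⟩
      (2 · r₃ ∙ r₄) ∙ (p₁ ∙ p₂)                ≈⟨ ∙-congʳ (∙-cong (·-cong 2 e₃) e₄) ⟨
      (2 · (t₃ ∙ p₃) ∙ (t₄ ∙ p₄)) ∙ (p₁ ∙ p₂)
        ≈⟨ solve 6 (λ a b c d e h → (((id ⊕ (a ⊕ b)) ⊕ (a ⊕ b)) ⊕ (c ⊕ d)) ⊕ (e ⊕ h)
                                    ⊜ (((id ⊕ a) ⊕ a) ⊕ c) ⊕ ((e ⊕ h) ⊕ (((id ⊕ b) ⊕ b) ⊕ d))) refl t₃ p₃ t₄ p₄ p₁ p₂ ⟩
      (2 · t₃ ∙ t₄) ∙ ((p₁ ∙ p₂) ∙ (2 · p₃ ∙ p₄)) ∎)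

  eliminate : ∀ {t₀ t₁ t₂ σ p₀ p₁ r₀ r₁} →
    t₂ ∙ t₀ ≈ 2 · t₁ ∙ σ → t₁ ∙ p₁ ≈ r₁ → t₀ ∙ p₀ ≈ r₀ →
    t₂ ∙ (r₀ ∙ 2 · p₁) ≈ (2 · r₁ ∙ σ) ∙ p₀
  eliminate {t₀} {t₁} {t₂} {σ} {p₀} {p₁} {r₀} {r₁} rec e₁ e₀ = begin
    t₂ ∙ (r₀ ∙ 2 · p₁)             ≈⟨ ∙-congˡ (∙-congʳ e₀) ⟨
    t₂ ∙ ((t₀ ∙ p₀) ∙ 2 · p₁)       ≈⟨ solve 4 (λ a b c d → a ⊕ ((b ⊕ c) ⊕ d) ⊜ (a ⊕ b) ⊕ (c ⊕ d)) refl t₂ t₀ p₀ (2 · p₁) ⟩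
    (t₂ ∙ t₀) ∙ (p₀ ∙ 2 · p₁)       ≈⟨ ∙-congʳ rec ⟩
    (2 · t₁ ∙ σ) ∙ (p₀ ∙ 2 · p₁)
      ≈⟨ solve 4 (λ a b c d → (((id ⊕ a) ⊕ a) ⊕ b) ⊕ (c ⊕ ((id ⊕ d) ⊕ d))
                              ⊜ (((id ⊕ (a ⊕ d)) ⊕ (a ⊕ d)) ⊕ b) ⊕ c) refl t₁ σ p₀ p₁ ⟩
    (2 · (t₁ ∙ p₁) ∙ σ) ∙ p₀        ≈⟨ ∙-congʳ (∙-congʳ (·-cong 2 e₁)) ⟩
    (2 · r₁ ∙ σ) ∙ p₀              ∎

  isolate : ∀ {x p q r t} → x ∙ (p ∙ q) ≈ r ∙ t → x ≈ ((r ∙ p ⁻¹) ∙ t) ∙ q ⁻¹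
  isolate {x} {p} {q} {r} {t} eq = ∙-cancelʳ (p ∙ q) _ _ (begin
    x ∙ (p ∙ q)                            ≈⟨ eq ⟩
    r ∙ t                                  ≈⟨ identityʳ _ ⟨
    (r ∙ t) ∙ ε                            ≈⟨ ∙-congˡ (identityʳ ε) ⟨
    (r ∙ t) ∙ (ε ∙ ε)                      ≈⟨ ∙-congˡ (∙-cong (inverseʳ p) (inverseʳ q)) ⟨
    (r ∙ t) ∙ ((p ∙ p ⁻¹) ∙ (q ∙ q ⁻¹))
      ≈⟨ solve 6 (λ r p p′ t q q′ → (r ⊕ t) ⊕ ((p ⊕ p′) ⊕ (q ⊕ q′)) ⊜ (((r ⊕ p′) ⊕ t) ⊕ q′) ⊕ (p ⊕ q))
                 refl r p (p ⁻¹) t q (q ⁻¹) ⟩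
    (((r ∙ p ⁻¹) ∙ t) ∙ q ⁻¹) ∙ (p ∙ q)   ∎)

  -- Second-order prefix sums relative to a base point b.  T₋, T₊ and S are
  -- second differences of Φ, which turns their recurrences into bookkeeping
  -- of multiplicities.
  module PrefixSums (b : ℤ) where

    F : ℕ → Carrier
    F m = Σ1 m (λ k → f (b + + k))

    Φ : ℕ → Carrier
    Φ zero = ε
    Φ (suc m) = Φ m ∙ F m

    window : ℕ → ℕ → Carrier
    window u y = Σ1 y (λ k → f ((b + + u) + + k))

    shift : ∀ u k → (b + + u) + + k ≡ b + + (u +ℕ k)
    shift u k = ≡.trans (ℤ.+-assoc b (+ u) (+ k)) (≡.cong (λ z → b + z) (≡.sym (ℤ.pos-+ u k)))

    window-F : ∀ u y → window u y ∙ F u ≈ F (u +ℕ y)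
    window-F u zero = trans (identityˡ _) (reflexive (≡.cong F (≡.sym (ℕ.+-identityʳ u))))
    window-F u (suc y) = begin
      (window u y ∙ f ((b + + u) + + suc y)) ∙ F u
        ≈⟨ solve 3 (λ p q r → (p ⊕ q) ⊕ r ⊜ (p ⊕ r) ⊕ q) refl _ _ _ ⟩
      (window u y ∙ F u) ∙ f ((b + + u) + + suc y)
        ≈⟨ ∙-cong (window-F u y) (reflexive (≡.cong f (≡.trans (shift u (suc y)) (≡.cong (λ m → b + + m) (ℕ.+-suc u y))))) ⟩
      F (suc (u +ℕ y))   ≡⟨ ≡.cong F (ℕ.+-suc u y) ⟨
      F (u +ℕ suc y)     ∎

    Φ-extend : ∀ m y → Σ1 y (λ i → F (m +ℕ (i ∸ 1))) ∙ Φ m ≈ Φ (m +ℕ y)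
    Φ-extend m zero = trans (identityˡ _) (reflexive (≡.cong Φ (≡.sym (ℕ.+-identityʳ m))))
    Φ-extend m (suc y) = begin
      (Σ1 y (λ i → F (m +ℕ (i ∸ 1))) ∙ F (m +ℕ y)) ∙ Φ m
        ≈⟨ solve 3 (λ p q r → (p ⊕ q) ⊕ r ⊜ (p ⊕ r) ⊕ q) refl _ _ _ ⟩
      (Σ1 y (λ i → F (m +ℕ (i ∸ 1))) ∙ Φ m) ∙ F (m +ℕ y)
        ≈⟨ ∙-congʳ (Φ-extend m y) ⟩
      Φ (suc (m +ℕ y))   ≡⟨ ≡.cong Φ (ℕ.+-suc m y) ⟨
      Φ (m +ℕ suc y)     ∎

    T₋-partial-sums : ∀ u y → T₋ (b + + u) y ∙ y · F u ≈ Σ1 y (λ k → F (u +ℕ k))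
    T₋-partial-sums u y = begin
      T₋ (b + + u) y ∙ y · F u
        ≈⟨ ∙-cong (Σ1-descending-weights y (λ k → f ((b + + u) + + k))) (sym (Σ1-const y (F u))) ⟩
      Σ1 y (λ k → window u k) ∙ Σ1 y (λ _ → F u)   ≈⟨ Σ1-∙ y _ _ ⟨
      Σ1 y (λ k → window u k ∙ F u)                 ≈⟨ Σ1-cong y (λ k _ → window-F u (suc k)) ⟩
      Σ1 y (λ k → F (u +ℕ k))                       ∎

    T₋-Φ : ∀ u y → T₋ (b + + u) y ∙ suc y · Φ (suc u) ≈ Φ (suc (u +ℕ y)) ∙ y · Φ u
    T₋-Φ u y = begin
      T₋ (b + + u) y ∙ (y · (Φ u ∙ F u) ∙ Φ (suc u))
        ≈⟨ ∙-congˡ (∙-congʳ (·-∙ y (Φ u) (F u))) ⟩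
      T₋ (b + + u) y ∙ ((y · Φ u ∙ y · F u) ∙ Φ (suc u))
        ≈⟨ solve 4 (λ t p q r → t ⊕ ((p ⊕ q) ⊕ r) ⊜ ((t ⊕ q) ⊕ r) ⊕ p) refl _ _ _ _ ⟩
      ((T₋ (b + + u) y ∙ y · F u) ∙ Φ (suc u)) ∙ y · Φ u
        ≈⟨ ∙-congʳ (∙-congʳ (T₋-partial-sums u y)) ⟩
      (Σ1 y (λ k → F (u +ℕ k)) ∙ Φ (suc u)) ∙ y · Φ u
        ≈⟨ ∙-congʳ (∙-congʳ (Σ1-cong y (λ k _ → reflexive (≡.cong F (ℕ.+-suc u k))))) ⟩
      (Σ1 y (λ i → F (suc u +ℕ (i ∸ 1))) ∙ Φ (suc u)) ∙ y · Φ u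
        ≈⟨ ∙-congʳ (Φ-extend (suc u) y) ⟩
      Φ (suc (u +ℕ y)) ∙ y · Φ u ∎

    -- T₊ follows from T₋, since the weights of T₊ and T₋ add up to y+1.
    T₊-Φ : ∀ u y → T₊ (b + + u) y ∙ suc y · Φ (u +ℕ y) ≈ y · Φ (suc (u +ℕ y)) ∙ Φ u
    T₊-Φ u y = ∙-cancelʳ (Φ (suc (u +ℕ y)) ∙ y · Φ u) _ _ (begin
      (T₊x ∙ suc y · Φ (u +ℕ y)) ∙ (Φ (suc (u +ℕ y)) ∙ y · Φ u)
        ≈⟨ ∙-congˡ (T₋-Φ u y) ⟨
      (T₊x ∙ suc y · Φ (u +ℕ y)) ∙ (T₋x ∙ suc y · Φ (suc u))
        ≈⟨ solve 4 (λ p q r s → (p ⊕ q) ⊕ (r ⊕ s) ⊜ (p ⊕ r) ⊕ (q ⊕ s)) refl _ _ _ _ ⟩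
      (T₊x ∙ T₋x) ∙ (suc y · Φ (u +ℕ y) ∙ suc y · Φ (suc u))
        ≈⟨ ∙-cong (Σ1-complementary-weights y _) (sym (·-∙ (suc y) _ _)) ⟩
      suc y · window u y ∙ suc y · (Φ (u +ℕ y) ∙ (Φ u ∙ F u))
        ≈⟨ ·-∙ (suc y) _ _ ⟨
      suc y · (window u y ∙ (Φ (u +ℕ y) ∙ (Φ u ∙ F u)))
        ≈⟨ ·-cong (suc y) (solve 4 (λ s p q r → s ⊕ (p ⊕ (q ⊕ r)) ⊜ (p ⊕ (s ⊕ r)) ⊕ q) refl _ _ _ _) ⟩
      suc y · ((Φ (u +ℕ y) ∙ (window u y ∙ F u)) ∙ Φ u)
        ≈⟨ ·-cong (suc y) (∙-congʳ (∙-congˡ (window-F u y))) ⟩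
      suc y · (Φ (suc (u +ℕ y)) ∙ Φ u)
        ≈⟨ ·-∙ (suc y) _ _ ⟩
      (y · Φ (suc (u +ℕ y)) ∙ Φ (suc (u +ℕ y))) ∙ (y · Φ u ∙ Φ u)
        ≈⟨ solve 4 (λ p q r s → (p ⊕ q) ⊕ (r ⊕ s) ⊜ (p ⊕ s) ⊕ (q ⊕ r)) refl _ _ _ _ ⟩
      (y · Φ (suc (u +ℕ y)) ∙ Φ u) ∙ (Φ (suc (u +ℕ y)) ∙ y · Φ u) ∎)
      where
      T₊x = T₊ (b + + u) y
      T₋x = T₋ (b + + u) y

    -- S sums y windows of length y; each is a difference of two values of F.
    S-Φ : ∀ u y → S (b + + u) y ∙ 2 · Φ (u +ℕ y) ≈ Φ (u +ℕ y +ℕ y) ∙ Φ u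
    S-Φ u y = begin
      S (b + + u) y ∙ ((ε ∙ Φ (u +ℕ y)) ∙ Φ (u +ℕ y))
        ≈⟨ ∙-congˡ (∙-cong (identityˡ _) (sym (Φ-extend u y))) ⟩
      S (b + + u) y ∙ (Φ (u +ℕ y) ∙ (lower ∙ Φ u))
        ≈⟨ solve 4 (λ s g x h → s ⊕ (g ⊕ (x ⊕ h)) ⊜ ((s ⊕ x) ⊕ g) ⊕ h) refl _ _ _ _ ⟩
      ((S (b + + u) y ∙ lower) ∙ Φ (u +ℕ y)) ∙ Φ u
        ≈⟨ ∙-congʳ (∙-congʳ windows-F) ⟩
      (Σ1 y (λ i → F ((u +ℕ y) +ℕ (i ∸ 1))) ∙ Φ (u +ℕ y)) ∙ Φ u
        ≈⟨ ∙-congʳ (Φ-extend (u +ℕ y) y) ⟩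
      Φ (u +ℕ y +ℕ y) ∙ Φ u ∎
      where
      lower = Σ1 y (λ i → F (u +ℕ (i ∸ 1)))
      point : ∀ i j → ((b + + u) + + suc i) + + j ≡ (b + + (u +ℕ i)) + + suc j
      point i j =
        ≡.trans (≡.cong (_+ + j) (shift u (suc i)))
        (≡.trans (shift (u +ℕ suc i) j)
        (≡.trans (≡.cong (λ m → b + + m) (shuffle u i j))
                 (≡.sym (shift (u +ℕ i) (suc j)))))
        where
        shuffle : ∀ u i j → u +ℕ suc i +ℕ j ≡ u +ℕ i +ℕ suc j
        shuffle = ℕ-Solver.solve-∀
      column : ∀ i → Σ1 y (λ j → f ((b + + u) + + suc i + + (j ∸ 1))) ≈ window (u +ℕ i) y
      column i = Σ1-cong y (λ j _ → reflexive (≡.cong f (point i j)))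
      windows-F : S (b + + u) y ∙ lower ≈ Σ1 y (λ i → F ((u +ℕ y) +ℕ (i ∸ 1)))
      windows-F = begin
        S (b + + u) y ∙ lower  ≈⟨ Σ1-∙ y _ _ ⟨
        Σ1 y (λ i → Σ1 y (λ j → f ((b + + u) + + i + + (j ∸ 1))) ∙ F (u +ℕ (i ∸ 1)))
          ≈⟨ Σ1-cong y (λ i _ → trans (∙-congʳ (column i)) (trans (window-F (u +ℕ i) y)
               (reflexive (≡.cong F (shuffle′ u i y))))) ⟩
        Σ1 y (λ i → F ((u +ℕ y) +ℕ (i ∸ 1))) ∎
        where
        shuffle′ : ∀ u i y → u +ℕ i +ℕ y ≡ u +ℕ y +ℕ i
        shuffle′ = ℕ-Solver.solve-∀

  -- For w = 2u + v + 1 and L = u + v + 1: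
  --   T₋(a, w) ∙ T₊(a − v, v)      ≈ 2·T₋(a, u)      ∙ S(a − v, L),
  --   T₊(a − w, w) ∙ T₋(a, v)      ≈ 2·T₊(a − u, u)  ∙ S(a − w, L).
  -- Written through Φ, both reduce (via `transfer`) to the following count of
  -- multiplicities of two values x, y of Φ.
  multiplicities : ∀ u v x y →
    suc (u +ℕ u +ℕ v) · x ∙ (v · y ∙ 2 · (suc u · y)) ≈ (2 · (u · x) ∙ suc v · x) ∙ suc (suc (u +ℕ u +ℕ v)) · y
  multiplicities u v x y = begin
    suc (u +ℕ u +ℕ v) · x ∙ (v · y ∙ 2 · (suc u · y))
      ≈⟨ ∙-congʳ (·-2u+v+1 u v x) ⟩
    (((u · x ∙ u · x) ∙ v · x) ∙ x) ∙ (v · y ∙ 2 · (suc u · y))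
      ≈⟨ solve 6 (λ ux vx x uy vy y → ((((ux ⊕ ux) ⊕ vx) ⊕ x) ⊕ (vy ⊕ ((id ⊕ (uy ⊕ y)) ⊕ (uy ⊕ y))))
                                      ⊜ (((id ⊕ ux) ⊕ ux) ⊕ (vx ⊕ x)) ⊕ (((((uy ⊕ uy) ⊕ vy) ⊕ y) ⊕ y)))
                 refl (u · x) (v · x) x (u · y) (v · y) y ⟩
    (2 · (u · x) ∙ suc v · x) ∙ ((((u · y ∙ u · y) ∙ v · y) ∙ y) ∙ y)
      ≈⟨ ∙-congˡ (∙-congʳ (·-2u+v+1 u v y)) ⟨
    (2 · (u · x) ∙ suc v · x) ∙ suc (suc (u +ℕ u +ℕ v)) · y ∎

  module RecurrencesAtBase (b : ℤ) (u v : ℕ) where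
    open PrefixSums b

    w L : ℕ
    w = suc (u +ℕ u +ℕ v)
    L = suc (u +ℕ v)

    2L≡ : L +ℕ L ≡ suc (v +ℕ w)
    2L≡ = arith u v
      where
      arith : ∀ u v → suc (u +ℕ v) +ℕ suc (u +ℕ v) ≡ suc (v +ℕ suc (u +ℕ u +ℕ v))
      arith = ℕ-Solver.solve-∀

    T₋-recurrence-at : T₋ (b + + v) w ∙ T₊ (b + + 0) v ≈ 2 · T₋ (b + + v) u ∙ S (b + + 0) L
    T₋-recurrence-at = transfer
      (trans (T₋-Φ v w) (∙-congʳ (reflexive (≡.cong Φ (≡.sym 2L≡)))))
      (T₊-Φ 0 v)
      (trans (T₋-Φ v u) (∙-congʳ (reflexive (≡.cong (λ m → Φ (suc m)) (ℕ.+-comm v u)))))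
      (S-Φ 0 L)
      (begin
        ((Z ∙ w · x) ∙ (v · y ∙ ε)) ∙ (2 · (suc u · y) ∙ 2 · z)
          ≈⟨ solve 6 (λ Z z wx vy suy e → ((Z ⊕ wx) ⊕ (vy ⊕ e)) ⊕ (((id ⊕ suy) ⊕ suy) ⊕ ((id ⊕ z) ⊕ z))
                                          ⊜ ((Z ⊕ e) ⊕ ((id ⊕ z) ⊕ z)) ⊕ (wx ⊕ (vy ⊕ ((id ⊕ suy) ⊕ suy))))
                     refl Z z (w · x) (v · y) (suc u · y) ε ⟩
        ((Z ∙ ε) ∙ 2 · z) ∙ (w · x ∙ (v · y ∙ 2 · (suc u · y)))
          ≈⟨ ∙-congˡ (multiplicities u v x y) ⟩
        ((Z ∙ ε) ∙ 2 · z) ∙ ((2 · (u · x) ∙ suc v · x) ∙ suc w · y)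
          ≈⟨ solve 6 (λ Z z ux svx swy e → ((Z ⊕ e) ⊕ ((id ⊕ z) ⊕ z)) ⊕ ((((id ⊕ ux) ⊕ ux) ⊕ svx) ⊕ swy)
                                           ⊜ (((id ⊕ (z ⊕ ux)) ⊕ (z ⊕ ux)) ⊕ (Z ⊕ e)) ⊕ (swy ⊕ svx))
                     refl Z z (u · x) (suc v · x) (suc w · y) ε ⟩
        (2 · (z ∙ u · x) ∙ (Z ∙ ε)) ∙ (suc w · y ∙ suc v · x) ∎)
      where
      x = Φ v
      y = Φ (suc v)
      z = Φ L
      Z = Φ (L +ℕ L)

    T₊-recurrence-at : T₊ (b + + 0) w ∙ T₋ (b + + w) v ≈ 2 · T₊ (b + + L) u ∙ S (b + + 0) L
    T₊-recurrence-at = transfer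
      (T₊-Φ 0 w)
      (trans (T₋-Φ w v) (∙-congʳ (reflexive (≡.cong Φ (≡.trans (≡.cong suc (ℕ.+-comm w v)) (≡.sym 2L≡))))))
      (≡.subst (λ m → T₊ (b + + L) u ∙ suc u · Φ m ≈ u · Φ (suc m) ∙ Φ L) L+u≡w (T₊-Φ L u))
      (S-Φ 0 L)
      (begin
        ((w · x ∙ ε) ∙ (Z ∙ v · y)) ∙ (2 · (suc u · y) ∙ 2 · z)
          ≈⟨ solve 6 (λ Z z wx vy suy e → ((wx ⊕ e) ⊕ (Z ⊕ vy)) ⊕ (((id ⊕ suy) ⊕ suy) ⊕ ((id ⊕ z) ⊕ z))
                                          ⊜ ((Z ⊕ e) ⊕ ((id ⊕ z) ⊕ z)) ⊕ (wx ⊕ (vy ⊕ ((id ⊕ suy) ⊕ suy))))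
                     refl Z z (w · x) (v · y) (suc u · y) ε ⟩
        ((Z ∙ ε) ∙ 2 · z) ∙ (w · x ∙ (v · y ∙ 2 · (suc u · y)))
          ≈⟨ ∙-congˡ (multiplicities u v x y) ⟩
        ((Z ∙ ε) ∙ 2 · z) ∙ ((2 · (u · x) ∙ suc v · x) ∙ suc w · y)
          ≈⟨ solve 6 (λ Z z ux svx swy e → ((Z ⊕ e) ⊕ ((id ⊕ z) ⊕ z)) ⊕ ((((id ⊕ ux) ⊕ ux) ⊕ svx) ⊕ swy)
                                           ⊜ (((id ⊕ (ux ⊕ z)) ⊕ (ux ⊕ z)) ⊕ (Z ⊕ e)) ⊕ (swy ⊕ svx))
                     refl Z z (u · x) (suc v · x) (suc w · y) ε ⟩
        (2 · (u · x ∙ z) ∙ (Z ∙ ε)) ∙ (suc w · y ∙ suc v · x) ∎)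
      where
      x = Φ (suc w)
      y = Φ w
      z = Φ L
      Z = Φ (L +ℕ L)
      L+u≡w : L +ℕ u ≡ w
      L+u≡w = arith u v
        where
        arith : ∀ u v → suc (u +ℕ v) +ℕ u ≡ suc (u +ℕ u +ℕ v)
        arith = ℕ-Solver.solve-∀

  a-v+v≡a : ∀ a x → (a -ℤ x) + x ≡ a
  a-v+v≡a = ℤ-Solver.solve-∀

  T₋-recurrence : ∀ a u v {w L} → w ≡ suc (u +ℕ u +ℕ v) → L ≡ suc (u +ℕ v) →
    T₋ a w ∙ T₊ (a -ℤ + v) v ≈ 2 · T₋ a u ∙ S (a -ℤ + v) L
  T₋-recurrence a u v {w} {L} ≡.refl ≡.refl =
    ≡.subst₂ (λ x y → T₋ x w ∙ T₊ y v ≈ 2 · T₋ x u ∙ S y L) (a-v+v≡a a (+ v)) (ℤ.+-identityʳ (a -ℤ + v))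
      (RecurrencesAtBase.T₋-recurrence-at (a -ℤ + v) u v)

  T₊-recurrence : ∀ a u v {w L} → w ≡ suc (u +ℕ u +ℕ v) → L ≡ suc (u +ℕ v) →
    T₊ (a -ℤ + w) w ∙ T₋ a v ≈ 2 · T₊ (a -ℤ + u) u ∙ S (a -ℤ + w) L
  T₊-recurrence a u v {w} {L} ≡.refl ≡.refl =
    ≡.subst (λ x → T₊ (a -ℤ + w) w ∙ T₋ a v ≈ 2 · T₊ x u ∙ S (a -ℤ + w) L) b+L≡a-u
      (≡.subst₂ (λ x y → T₊ x w ∙ T₋ y v ≈ 2 · T₊ ((a -ℤ + w) + + L) u ∙ S x L)
        (ℤ.+-identityʳ (a -ℤ + w)) (a-v+v≡a a (+ w)) (RecurrencesAtBase.T₊-recurrence-at (a -ℤ + w) u v))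
    where
    b+L≡a-u : (a -ℤ + w) + + L ≡ a -ℤ + u
    b+L≡a-u = ≡.trans (≡.cong (λ m → (a -ℤ m) + + L) w≡L+u) (cancel a (+ L) (+ u))
      where
      w≡L+u : + w ≡ + L + + u
      w≡L+u = ≡.trans (≡.cong +_ (arith u v)) (ℤ.pos-+ L u)
        where
        arith : ∀ u v → suc (u +ℕ u +ℕ v) ≡ suc (u +ℕ v) +ℕ u
        arith = ℕ-Solver.solve-∀
      cancel : ∀ a x y → (a -ℤ (x + y)) + x ≡ a -ℤ y
      cancel = ℤ-Solver.solve-∀

  module PairedRecurrence (L : ℕ) where

    combination : (ℕ → ℕ) → (ℕ → Carrier) → Carrier
    combination c g = Σ1 L (λ i → c (i ∸ 1) · g (i ∸ 1))

    combination-+ : ∀ c d g → combination (λ j → c j +ℕ d j) g ≈ combination c g ∙ combination d g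
    combination-+ c d g = trans (Σ1-cong L (λ k _ → ·-+ (c k) (d k) (g k))) (Σ1-∙ L _ _)

    combination-0 : ∀ g → combination (λ _ → 0) g ≈ ε
    combination-0 g = Σ1-ε L _ (λ _ _ → refl)

    combination-δ : ∀ s g → s < L → combination (δ s) g ≈ g s
    combination-δ s g s<L = pick L s<L
      where
      pick : ∀ M → s < M → Σ1 M (λ i → δ s (i ∸ 1) · g (i ∸ 1)) ≈ g s
      pick (suc M) s<1+M with ℕ.m≤n⇒m<n∨m≡n s<1+M
      ... | inj₁ (s≤s s<M) = trans (∙-cong (pick M s<M) (reflexive (≡.cong (_· g M) (δ-above s<M)))) (identityʳ _)
      ... | inj₂ ≡.refl = begin
        Σ1 s (λ i → δ s (i ∸ 1) · g (i ∸ 1)) ∙ δ s s · g s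
          ≈⟨ ∙-cong (Σ1-ε s _ (λ k k<s → reflexive (≡.cong (_· g k) (δ-below k<s))))
                    (reflexive (≡.cong (_· g s) (δ-diag s))) ⟩
        ε ∙ (ε ∙ g s)   ≈⟨ trans (identityˡ _) (identityˡ _) ⟩
        g s             ∎

    coefA-step : ∀ s g → s < L →
      combination (coefA (2 +ℕ s)) g ≈ (2 · combination (coefA (1 +ℕ s)) g ∙ combination (coefB s) g) ∙ g s
    coefA-step s g s<L = begin
      combination (coefA (2 +ℕ s)) g
        ≈⟨ combination-+ (λ j → coefA (1 +ℕ s) j +ℕ coefA (1 +ℕ s) j +ℕ coefB s j) (δ s) g ⟩
      combination (λ j → coefA (1 +ℕ s) j +ℕ coefA (1 +ℕ s) j +ℕ coefB s j) g ∙ combination (δ s) g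
        ≈⟨ ∙-cong (trans (combination-+ (λ j → coefA (1 +ℕ s) j +ℕ coefA (1 +ℕ s) j) (coefB s) g)
                         (∙-congʳ (combination-+ (coefA (1 +ℕ s)) (coefA (1 +ℕ s)) g)))
                  (combination-δ s g s<L) ⟩
      ((A₁ ∙ A₁) ∙ combination (coefB s) g) ∙ g s
        ≈⟨ ∙-congʳ (∙-congʳ (∙-congʳ (identityˡ A₁))) ⟨
      (2 · A₁ ∙ combination (coefB s) g) ∙ g s ∎
      where A₁ = combination (coefA (1 +ℕ s)) g

    coefB-step : ∀ s g → combination (coefB (2 +ℕ s)) g ≈ combination (coefA s) g ∙ 2 · combination (coefB (1 +ℕ s)) g
    coefB-step s g = begin
      combination (coefB (2 +ℕ s)) g
        ≈⟨ trans (combination-+ (coefA s) (λ j → coefB (1 +ℕ s) j +ℕ coefB (1 +ℕ s) j) g)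
                 (∙-congˡ (combination-+ (coefB (1 +ℕ s)) (coefB (1 +ℕ s)) g)) ⟩
      combination (coefA s) g ∙ (B₁ ∙ B₁)
        ≈⟨ ∙-congˡ (∙-congʳ (identityˡ B₁)) ⟨
      combination (coefA s) g ∙ 2 · B₁ ∎
      where B₁ = combination (coefB (1 +ℕ s)) g

    Solved : (X Y σX σY : ℕ → Carrier) → ℕ → Set ℓ
    Solved X Y σX σY s = X s ∙ (ĉ s · Y 1 ∙ combination (coefB s) σY) ≈ suc (ĉ s) · X 1 ∙ combination (coefA s) σX

    solved-start : ∀ {x} (X₁ y : Carrier) σX σY → x ≈ X₁ →
      x ∙ (0 · y ∙ combination (λ _ → 0) σY) ≈ 1 · X₁ ∙ combination (λ _ → 0) σX
    solved-start X₁ y σX σY x≈X₁ = begin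
      _ ∙ (ε ∙ combination (λ _ → 0) σY)  ≈⟨ ∙-cong x≈X₁ (trans (identityˡ _) (combination-0 σY)) ⟩
      X₁ ∙ ε                               ≈⟨ ∙-cong (identityˡ X₁) (combination-0 σX) ⟨
      (ε ∙ X₁) ∙ combination (λ _ → 0) σX ∎

    solved-step : ∀ X Y σX σY s → s < L →
      X (2 +ℕ s) ∙ Y s ≈ 2 · X (1 +ℕ s) ∙ σX s →
      Solved X Y σX σY (1 +ℕ s) → Solved Y X σY σX s → Solved X Y σX σY (2 +ℕ s)
    solved-step X Y σX σY s s<L rec X-solved Y-solved = begin
      X (2 +ℕ s) ∙ (ĉ (2 +ℕ s) · y₁ ∙ combination (coefB (2 +ℕ s)) σY)
        ≈⟨ ∙-congˡ Y-terms ⟨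
      X (2 +ℕ s) ∙ ((suc h₀ · y₁ ∙ A₀Y) ∙ 2 · (h₁ · y₁ ∙ B₁Y))
        ≈⟨ eliminate rec X-solved Y-solved ⟩
      (2 · (suc h₁ · x₁ ∙ A₁X) ∙ σX s) ∙ (h₀ · x₁ ∙ B₀X)
        ≈⟨ X-terms ⟩
      suc (ĉ (2 +ℕ s)) · x₁ ∙ combination (coefA (2 +ℕ s)) σX ∎
      where
      h₀ = ĉ s
      h₁ = ĉ (1 +ℕ s)
      x₁ = X 1
      y₁ = Y 1
      A₀Y = combination (coefA s) σY
      B₁Y = combination (coefB (1 +ℕ s)) σY
      A₁X = combination (coefA (1 +ℕ s)) σX
      B₀X = combination (coefB s) σX

      Y-terms : (suc h₀ · y₁ ∙ A₀Y) ∙ 2 · (h₁ · y₁ ∙ B₁Y) ≈ ĉ (2 +ℕ s) · y₁ ∙ combination (coefB (2 +ℕ s)) σY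
      Y-terms = begin
        ((h₀ · y₁ ∙ y₁) ∙ A₀Y) ∙ 2 · (h₁ · y₁ ∙ B₁Y)
          ≈⟨ solve 5 (λ hy h0y y a b → ((h0y ⊕ y) ⊕ a) ⊕ ((id ⊕ (hy ⊕ b)) ⊕ (hy ⊕ b))
                                       ⊜ (((hy ⊕ hy) ⊕ h0y) ⊕ y) ⊕ (a ⊕ ((id ⊕ b) ⊕ b)))
                     refl (h₁ · y₁) (h₀ · y₁) y₁ A₀Y B₁Y ⟩
        (((h₁ · y₁ ∙ h₁ · y₁) ∙ h₀ · y₁) ∙ y₁) ∙ (A₀Y ∙ 2 · B₁Y)
          ≈⟨ ∙-cong (·-2u+v+1 h₁ h₀ y₁) (coefB-step s σY) ⟨
        ĉ (2 +ℕ s) · y₁ ∙ combination (coefB (2 +ℕ s)) σY ∎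

      X-terms : (2 · (suc h₁ · x₁ ∙ A₁X) ∙ σX s) ∙ (h₀ · x₁ ∙ B₀X) ≈ suc (ĉ (2 +ℕ s)) · x₁ ∙ combination (coefA (2 +ℕ s)) σX
      X-terms = begin
        (2 · ((h₁ · x₁ ∙ x₁) ∙ A₁X) ∙ σX s) ∙ (h₀ · x₁ ∙ B₀X)
          ≈⟨ solve 6 (λ hx h0x x a b σ → (((id ⊕ ((hx ⊕ x) ⊕ a)) ⊕ ((hx ⊕ x) ⊕ a)) ⊕ σ) ⊕ (h0x ⊕ b)
                                         ⊜ ((((hx ⊕ hx) ⊕ h0x) ⊕ x) ⊕ x) ⊕ ((((id ⊕ a) ⊕ a) ⊕ b) ⊕ σ))
                     refl (h₁ · x₁) (h₀ · x₁) x₁ A₁X B₀X (σX s) ⟩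
        ((((h₁ · x₁ ∙ h₁ · x₁) ∙ h₀ · x₁) ∙ x₁) ∙ x₁) ∙ ((2 · A₁X ∙ B₀X) ∙ σX s)
          ≈⟨ ∙-cong (∙-congʳ (·-2u+v+1 h₁ h₀ x₁)) (coefA-step s σX s<L) ⟨
        suc (ĉ (2 +ℕ s)) · x₁ ∙ combination (coefA (2 +ℕ s)) σX ∎

    module Solution (X Y σX σY : ℕ → Carrier) (X₀≈X₁ : X 0 ≈ X 1) (Y₀≈Y₁ : Y 0 ≈ Y 1)
                    (recX : ∀ s → X (2 +ℕ s) ∙ Y s ≈ 2 · X (1 +ℕ s) ∙ σX s)
                    (recY : ∀ s → Y (2 +ℕ s) ∙ X s ≈ 2 · Y (1 +ℕ s) ∙ σY s) where

      Both : ℕ → Set ℓ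
      Both s = Solved X Y σX σY s × Solved Y X σY σX s

      consecutive : ∀ s → s ≤ L → Both s × Both (suc s)
      consecutive zero _ =
        (solved-start (X 1) (Y 1) σX σY X₀≈X₁ , solved-start (Y 1) (X 1) σY σX Y₀≈Y₁) ,
        (solved-start (X 1) (Y 1) σX σY refl , solved-start (Y 1) (X 1) σY σX refl)
      consecutive (suc s) s<L with consecutive s (ℕ.<⇒≤ s<L)
      ... | (X-s , Y-s) , (X-s+1 , Y-s+1) =
        (X-s+1 , Y-s+1) ,
        (solved-step X Y σX σY s s<L (recX s) X-s+1 Y-s , solved-step Y X σY σX s s<L (recY s) Y-s+1 X-s)

      solution : ∀ s → s ≤ suc L → Both s
      solution zero _ = proj₁ (consecutive 0 z≤n)
      solution (suc s) (s≤s s≤L) = proj₂ (consecutive s s≤L)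

  module Instance (a : ℤ) (K : ℕ) where
    X Y σX σY : ℕ → Carrier
    X s = T₋ a (len K s)
    Y s = T₊ (a -ℤ + len K s) (len K s)
    σX s = S₋⁽ s ⁾ a K
    σY s = S₊⁽ s ⁾ a K

    recX : ∀ s → X (2 +ℕ s) ∙ Y s ≈ 2 · X (1 +ℕ s) ∙ σX s
    recX s = T₋-recurrence a (len K (1 +ℕ s)) (len K s) (len-step K s) (lenS≡ K s)

    recY : ∀ s → Y (2 +ℕ s) ∙ X s ≈ 2 · Y (1 +ℕ s) ∙ σY s
    recY s = T₊-recurrence a (len K (1 +ℕ s)) (len K s) (len-step K s) (lenS≡ K s)

  module ClosedForm (n : ℕ) where
    open PairedRecurrence (suc n)

    -- Only the coefficients coefB (n+2) j with j ≤ n − 2 can be nonzero.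
    truncated : ∀ σ → combination (coefB (2 +ℕ n)) σ ≈ Σ0to-2 n (λ j → (+ coefB (2 +ℕ n) j) ·ℤ σ j)
    truncated σ = Σ1-truncate _ (ℕ.≤-trans (ℕ.m∸n≤m n 1) (ℕ.n≤1+n n))
      (λ k n-1≤k _ → reflexive (≡.cong (_· σ k) (coefB-vanishes (s≤s (s≤s (ℕ.≤-trans (ℕ.m≤n+m∸n n 1) (s≤s n-1≤k)))))))

    read-off : ∀ {x₁ y₁ U V} (x : Carrier) σX σY → x₁ ≡ U → y₁ ≡ V →
      x ∙ (ĉ (2 +ℕ n) · y₁ ∙ combination (coefB (2 +ℕ n)) σY) ≈ suc (ĉ (2 +ℕ n)) · x₁ ∙ combination (coefA (2 +ℕ n)) σX →
      x ≈ (((α n · U) ∙ (β n · V) ⁻¹) ∙ Σ0 n (λ j → (+ coefA (2 +ℕ n) j) ·ℤ σX j))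
          ∙ (Σ0to-2 n (λ j → (+ coefB (2 +ℕ n) j) ·ℤ σY j)) ⁻¹
    read-off {x₁} {y₁} x σX σY ≡.refl ≡.refl solved =
      trans (isolate solved)
        (∙-cong (∙-congʳ (∙-cong (reflexive (≡.cong (_· x₁) (≡.sym (α≡ n))))
                                 (⁻¹-cong (reflexive (≡.cong (_· y₁) (≡.sym (β≡ n)))))))
                (⁻¹-cong (truncated σY)))

    closed-form : ∀ a K →
      (T₋⁽ n ⁾ a K ≈
         (((α n · T₋ a K) ∙ (β n · T₊ (a -ℤ + K) K) ⁻¹)
          ∙ Σ0 n (λ j → (+ coefA (2 +ℕ n) j) ·ℤ S₋⁽ j ⁾ a K))
         ∙ (Σ0to-2 n (λ j → (+ coefB (2 +ℕ n) j) ·ℤ S₊⁽ j ⁾ a K)) ⁻¹)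
      × (T₊⁽ n ⁾ a K ≈
         (((α n · T₊ (a -ℤ + K) K) ∙ (β n · T₋ a K) ⁻¹)
          ∙ Σ0 n (λ j → (+ coefA (2 +ℕ n) j) ·ℤ S₊⁽ j ⁾ a K))
         ∙ (Σ0to-2 n (λ j → (+ coefB (2 +ℕ n) j) ·ℤ S₋⁽ j ⁾ a K)) ⁻¹)
    closed-form a K =
      read-off (X (2 +ℕ n)) σX σY X₁≡ Y₁≡ (proj₁ solved) ,
      read-off (Y (2 +ℕ n)) σY σX Y₁≡ X₁≡ (proj₂ solved)
      where
      open Instance a K
      solved = Solution.solution X Y σX σY refl refl recX recY (2 +ℕ n) ℕ.≤-refl
      X₁≡ : X 1 ≡ T₋ a K
      X₁≡ = ≡.cong (T₋ a) (len-1 K)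
      Y₁≡ : Y 1 ≡ T₊ (a -ℤ + K) K
      Y₁≡ = ≡.cong (λ m → T₊ (a -ℤ + m) m) (len-1 K)


open Arithmetic using (coefA; coefB)

-- The identity holds for every K, every f and every abelian group; the
-- hypotheses on f, N, τ and i only serve to specify K = K_i.
lemma3 : ∀ {g ℓ : Level} (n : ℕ) →
  Σ[ A ∈ (ℕ → ℤ) ] Σ[ B ∈ (ℕ → ℤ) ]
    ((G : AbelianGroup g ℓ) (f : ℤ → AbelianGroup.Carrier G) (p : ℕ) →
     (∀ m → AbelianGroup._≈_ G (f (m + + p)) (f m)) →
     (a : ℤ) (N : ℕ) → 1 ≤ N →
     (τ : ℕ) → ⌊ q n ^ τ ∸ 1 /2⌋ ≤ N → N < ⌊ q n ^ suc τ ∸ 1 /2⌋ →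
     (i : ℕ) → 1 ≤ i → i +ℕ 1 ≤ τ →
     let open AbelianGroup G
         open Sums G f
         K = ⌊ q n ^ (τ ∸ i) ∸ 1 /2⌋
     in (T₋⁽ n ⁾ a K ≈
           (((α n · T₋ a K) ∙ (β n · T₊ (a -ℤ + K) K) ⁻¹)
            ∙ Σ0 n (λ j → A j ·ℤ S₋⁽ j ⁾ a K))
           ∙ (Σ0to-2 n (λ j → B j ·ℤ S₊⁽ j ⁾ a K)) ⁻¹)
      × (T₊⁽ n ⁾ a K ≈
           (((α n · T₊ (a -ℤ + K) K) ∙ (β n · T₋ a K) ⁻¹)
            ∙ Σ0 n (λ j → A j ·ℤ S₊⁽ j ⁾ a K))
           ∙ (Σ0to-2 n (λ j → B j ·ℤ S₋⁽ j ⁾ a K)) ⁻¹))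
lemma3 n =
  (λ j → + coefA (2 +ℕ n) j) , (λ j → + coefB (2 +ℕ n) j) ,
  λ G f _ _ a _ _ τ _ _ i _ _ → Development.ClosedForm.closed-form G f n a (⌊ q n ^ (τ ∸ i) ∸ 1 /2⌋)
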